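{- Let $X$ be a set, $R\subseteq X\times X$, and $\mathcal{M}=((X,\mathcal{C}_R),\mathcal{V})$ a closure model over the quasi-discrete closure space $(X,\mathcal{C}_R)$. For every $x\in X$ and SLCS formulas $\phi,\psi$: $\mathcal{M},x\models\phi\,\mathcal{U}\,\psi$ if and only if $\mathcal{M},x\models\phi$ and, for every path $p$ in $(X,\mathcal{C}_R)$ with $p(0)=x$ and every $l\in\mathbb{N}$, if $\mathcal{M},p(l)\models\neg\phi$ then there is $k\in\{1,\ldots,l\}$ with $\mathcal{M},p(k)\models\psi$.
   Context: $\mathcal{C}_R(A)=A\cup\{x\in X\mid\exists a\in A.(a,x)\in R\}$; closure spaces of this form are called quasi-discrete. In general a closure space is $(X,\mathcal{C})$ with $\mathcal{C}:2^X\to2^X$ satisfying $\mathcal{C}(\emptyset)=\emptyset$, $A\subseteq\mathcal{C}(A)$, $\mathcal{C}(A\cup B)=\mathcal{C}(A)\cup\mathcal{C}(B)$; the closure boundary of $A$ is $\mathcal{B}^+(A)=\mathcal{C}(A)\setminus A$. Fix a set $P$ of proposition letters; a closure model is $((X,\mathcal{C}),\mathcal{V})$ with $\mathcal{V}:P\to2^X$. SLCS formulas: $\Phi::=p\mid\top\mid\neg\Phi\mid\Phi\wedge\Phi\mid\lozenge\Phi\mid\Phi\,\mathcal{U}\,\Phi$. Satisfaction: $\mathcal{M},x\models p$ iff $x\in\mathcal{V}(p)$; $\top$ always; $\neg,\wedge$ as usual; $\mathcal{M},x\models\lozenge\phi$ iff $x\in\mathcal{C}(\{y\mid\mathcal{M},y\models\phi\})$;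 $\mathcal{M},x\models\phi\,\mathcal{U}\,\psi$ iff there is $A\subseteq X$ with $x\in A$, all points of $A$ satisfying $\phi$, and all points of $\mathcal{B}^+(A)$ satisfying $\psi$. A function $f$ between closure spaces is closure-continuous if $f(\mathcal{C}_1(A))\subseteq\mathcal{C}_2(f(A))$ for all $A$. A path in $(X,\mathcal{C})$ is a closure-continuous $p:(\mathbb{N},\mathcal{C}_\succ)\to(X,\mathcal{C})$ where $(n,m)\in\succ$ iff $m=n+1$. -}

module Defs where

open import Level using (Level; Lift; 0ℓ) renaming (suc to lsuc)
open import Data.Nat using (ℕ; zero; suc; _≤_)
open import Data.Product using (Σ; ∃; _×_; _,_)
open import Data.Sum using (_⊎_)
open import Data.Unit using (⊤)
open import Relation.Nullary using (¬_)
open import Relation.Binary.PropositionalEquality using (_≡_)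

Subset : Set → Set₁
Subset X = X → Set

_⊆_ : {X : Set} → Subset X → Subset X → Set
A ⊆ B = ∀ x → A x → B x

ClosureOp : Set → Set₁
ClosureOp X = Subset X → Subset X

-- Quasi-discrete closure induced by a relation R:
-- 𝒞_R(A) = A ∪ { x | ∃ a ∈ A. (a , x) ∈ R }
-- (level-polymorphic in the predicate, so that it can also be applied
--  to the Set₁-valued satisfaction sets of formulas)
𝒞[_] : {ℓ : Level} {X : Set} → (X → X → Set) → (X → Set ℓ) → (X → Set ℓ)
𝒞[ R ] A x = A x ⊎ (∃ λ a → A a × R a x)

ℬ⁺ : {X : Set} → ClosureOp X → Subset X → Subset X
ℬ⁺ 𝒞 A x = 𝒞 A x × ¬ A x

Im : {X Y : Set} → (X → Y) → Subset X → Subset Y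
Im f A y = ∃ λ x → A x × f x ≡ y

ClosureContinuous : {X Y : Set} → ClosureOp X → ClosureOp Y → (X → Y) → Set₁
ClosureContinuous {X} 𝒞₁ 𝒞₂ f = (A : Subset X) → Im f (𝒞₁ A) ⊆ 𝒞₂ (Im f A)

Succ : ℕ → ℕ → Set
Succ n m = m ≡ suc n

Path : {X : Set} → ClosureOp X → Set₁
Path {X} 𝒞 = Σ (ℕ → X) λ p → ClosureContinuous 𝒞[ Succ ] 𝒞 p

data Formula (P : Set) : Set where
  prop : P → Formula P
  ⊤̇    : Formula P
  ¬̇_   : Formula P → Formula P
  _∧̇_  : Formula P → Formula P → Formula P
  ◇    : Formula P → Formula P
  _𝒰_  : Formula P → Formula P → Formula P

Sat : {X P : Set} → (X → X → Set) → (P → Subset X) → X → Formula P → Set₁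
Sat R 𝒱 x (prop p) = Lift (lsuc 0ℓ) (𝒱 p x)
Sat R 𝒱 x ⊤̇ = Lift (lsuc 0ℓ) ⊤
Sat R 𝒱 x (¬̇ φ) = ¬ Sat R 𝒱 x φ
Sat R 𝒱 x (φ ∧̇ ψ) = Sat R 𝒱 x φ × Sat R 𝒱 x ψ
Sat R 𝒱 x (◇ φ) = 𝒞[ R ] (λ y → Sat R 𝒱 y φ) x
Sat {X} R 𝒱 x (φ 𝒰 ψ) =
  Σ (Subset X) λ A → Lift (lsuc 0ℓ) (A x)
    × (∀ y → A y → Sat R 𝒱 y φ)
    × (∀ y → ℬ⁺ 𝒞[ R ] A y → Sat R 𝒱 y ψ)

module Submission where

-- In a quasi-discrete space (X, 𝒞_R) a map p : ℕ → X is a path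
-- exactly when every step p n ↦ p (n+1) either stays put or follows R.
-- The statement is then proved for arbitrary predicates Φ, Ψ on X in place
-- of the satisfaction sets of φ and ψ (it is an instance definitionally).
--
-- (⇒) If A witnesses Φ 𝒰 Ψ at x and a path from x leaves A by time l, then
--     the first exit point lies on the boundary ℬ⁺(A), hence satisfies Ψ.
-- (⇐) Take for A the points reachable from x by a finite path that satisfies
--     Φ throughout and Ψ nowhere after time 0.  Every boundary point y is one
--     R-step beyond such a path; extending the path by y either shows y ∈ A
--     (if Φ y and ¬ Ψ y), which is impossible, or, when ¬ Φ y, the path
--     condition yields a Ψ-point on the extended path, which must be y.
-- Excluded middle is used to decide membership in A and the truth of Φ, Ψ.

open import Defs
open import Level using (Lift; lift; lower) renaming (suc to lsuc; zero to lzero)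
open import Axiom.ExcludedMiddle using (ExcludedMiddle)
open import Data.Nat using (ℕ; zero; suc; _≤_; z≤n; s≤s)
open import Data.Nat.Properties using (≤-refl; m≤n⇒m≤1+n; m≤n⇒m<n∨m≡n; m<1+n⇒m≤n)
open import Data.Product using (Σ; _×_; _,_; proj₁)
open import Data.Sum using (_⊎_; inj₁; inj₂; map₁)
open import Data.Empty using (⊥-elim)
open import Function.Bundles using (_⇔_; mk⇔)
open import Relation.Nullary using (¬_; Dec; yes; no)
open import Relation.Nullary.Decidable using (True; toWitness; fromWitness; map′)
open import Relation.Binary.PropositionalEquality using (_≡_; refl; sym; trans; subst)

≤-suc-cases : ∀ {j l} → j ≤ suc l → j ≤ l ⊎ j ≡ suc l
≤-suc-cases h = map₁ m<1+n⇒m≤n (m≤n⇒m<n∨m≡n h)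

module QuasiDiscretePaths {X : Set} (R : X → X → Set) where

  Step : (ℕ → X) → Set
  Step p = ∀ n → p (suc n) ≡ p n ⊎ R (p n) (p (suc n))

  step-closure : (A : Subset X) {u v : X} → A u → v ≡ u ⊎ R u v → 𝒞[ R ] A v
  step-closure A Au (inj₁ v≡u) = inj₁ (subst A (sym v≡u) Au)
  step-closure A Au (inj₂ r)   = inj₂ (_ , Au , r)

  step⇒continuous : (p : ℕ → X) → Step p → ClosureContinuous 𝒞[ Succ ] 𝒞[ R ] p
  step⇒continuous p st A y (n , inj₁ An , pn≡y) = inj₁ (n , An , pn≡y)
  step⇒continuous p st A y (_ , inj₂ (m , Am , refl) , pm+1≡y) =
    subst (𝒞[ R ] (Im p A)) pm+1≡y (step-closure (Im p A) (m , Am , refl) (st m))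

  -- Conversely, continuity on the singleton {n} gives the step at n.
  continuous⇒step : (p : ℕ → X) → ClosureContinuous 𝒞[ Succ ] 𝒞[ R ] p → Step p
  continuous⇒step p c n
    with c (λ m → m ≡ n) (p (suc n)) (suc n , inj₂ (n , refl , refl) , refl)
  ... | inj₁ (_ , refl , pn≡) = inj₁ (sym pn≡)
  ... | inj₂ (_ , (_ , refl , refl) , r) = inj₂ r

  extend : (ℕ → X) → ℕ → X → ℕ → X
  extend p zero    y zero    = p 0
  extend p zero    y (suc n) = y
  extend p (suc l) y zero    = p 0
  extend p (suc l) y (suc n) = extend (λ k → p (suc k)) l y n

  extend-start : ∀ p l y → extend p l y 0 ≡ p 0
  extend-start p zero    y = refl
  extend-start p (suc l) y = refl

  extend-agrees : ∀ p l y n → n ≤ l → extend p l y n ≡ p n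
  extend-agrees p zero    y zero    _       = refl
  extend-agrees p (suc l) y zero    _       = refl
  extend-agrees p (suc l) y (suc n) (s≤s h) = extend-agrees (λ k → p (suc k)) l y n h

  extend-end : ∀ p l y → extend p l y (suc l) ≡ y
  extend-end p zero    y = refl
  extend-end p (suc l) y = extend-end (λ k → p (suc k)) l y

  extend-step : ∀ p l y → Step p → R (p l) y → Step (extend p l y)
  extend-step p zero    y st r zero    = inj₂ r
  extend-step p zero    y st r (suc n) = inj₁ refl
  extend-step p (suc l) y st r zero
    rewrite extend-start (λ k → p (suc k)) l y = st 0
  extend-step p (suc l) y st r (suc n) =
    extend-step (λ k → p (suc k)) l y (λ m → st (suc m)) r n

  exit-boundary : (A : Subset X) → (∀ y → Dec (A y)) →
    (p : ℕ → X) → Step p → A (p 0) → ∀ n → ¬ A (p n) →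
    Σ ℕ λ k → 1 ≤ k × k ≤ n × ℬ⁺ 𝒞[ R ] A (p k)
  exit-boundary A A? p st A0 zero    ∉A = ⊥-elim (∉A A0)
  exit-boundary A A? p st A0 (suc m) ∉A with A? (p m)
  ... | yes Am = suc m , s≤s z≤n , ≤-refl , step-closure A Am (st m) , ∉A
  ... | no ∉Am with exit-boundary A A? p st A0 m ∉Am
  ...   | k , 1≤k , k≤m , bd = k , 1≤k , m≤n⇒m≤1+n k≤m , bd

module Until (em : ExcludedMiddle (lsuc lzero)) {X : Set} (R : X → X → Set)
             (Φ Ψ : X → Set₁) (x : X) where

  open QuasiDiscretePaths R

  UntilHolds : Set₁
  UntilHolds = Σ (Subset X) λ A → Lift (lsuc lzero) (A x)
    × (∀ y → A y → Φ y) × (∀ y → ℬ⁺ 𝒞[ R ] A y → Ψ y)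

  PathCondition : Set₁
  PathCondition = (p : Path 𝒞[ R ]) → proj₁ p 0 ≡ x → (l : ℕ) →
    ¬ Φ (proj₁ p l) → Σ ℕ λ k → 1 ≤ k × k ≤ l × Ψ (proj₁ p k)

  decide : (A : Subset X) → ∀ y → Dec (A y)
  decide A y = map′ lower lift em

  until⇒path : UntilHolds → Φ x × PathCondition
  until⇒path (A , lift Ax , A⊆Φ , ℬ⊆Ψ) = A⊆Φ x Ax , condition
    where
    condition : PathCondition
    condition (p , cont) p0≡x l ¬Φ
      with exit-boundary A (decide A) p (continuous⇒step p cont)
             (subst A (sym p0≡x) Ax) l (λ Apl → ¬Φ (A⊆Φ (p l) Apl))
    ... | k , 1≤k , k≤l , bd = k , 1≤k , k≤l , ℬ⊆Ψ (p k) bd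

  record Reach (y : X) : Set₁ where
    field
      path   : ℕ → X
      steps  : Step path
      start  : path 0 ≡ x
      len    : ℕ
      end    : path len ≡ y
      allΦ   : ∀ j → j ≤ len → Φ (path j)
      noneΨ  : ∀ j → 1 ≤ j → j ≤ len → ¬ Ψ (path j)

  reach-start : Φ x → Reach x
  reach-start Φx = record
    { path = λ _ → x ; steps = λ _ → inj₁ refl ; start = refl ; len = 0
    ; end = refl ; allΦ = λ { zero _ → Φx } ; noneΨ = λ { zero () ; (suc _) _ () } }

  Reachable : Subset X
  Reachable y = True (em {Reach y})

  module Extension {a y : X} (w : Reach a) (r : R a y) where
    open Reach w

    path′ : ℕ → X
    path′ = extend path len y

    steps′ : Step path′
    steps′ = extend-step path len y steps (subst (λ z → R z y) (sym end) r)

    start′ : path′ 0 ≡ x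
    start′ = trans (extend-start path len y) start

    along : (F : ℕ → X → Set₁) → (∀ j → j ≤ len → F j (path j)) → F (suc len) y →
            ∀ j → j ≤ suc len → F j (path′ j)
    along F old new j h with ≤-suc-cases h
    ... | inj₁ j≤len = subst (F j) (sym (extend-agrees path len y j j≤len)) (old j j≤len)
    ... | inj₂ refl  = subst (F j) (sym (extend-end path len y)) new

    reach-step : Φ y → ¬ Ψ y → Reach y
    reach-step Φy ¬Ψy = record
      { path = path′ ; steps = steps′ ; start = start′ ; len = suc len
      ; end = extend-end path len y
      ; allΦ = along (λ _ → Φ) allΦ Φy
      ; noneΨ = λ j 1≤j j≤ → along (λ i z → 1 ≤ i → ¬ Ψ z)
                                   (λ i i≤len 1≤i → noneΨ i 1≤i i≤len) (λ _ → ¬Ψy) j j≤ 1≤j }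

    forced-Ψ : PathCondition → ¬ Φ y → Ψ y
    forced-Ψ cond ¬Φy
      with cond (path′ , step⇒continuous path′ steps′) start′ (suc len)
                (λ Φend → ¬Φy (subst Φ (extend-end path len y) Φend))
    ... | k , 1≤k , k≤len+1 , Ψk with ≤-suc-cases k≤len+1
    ...   | inj₁ k≤len = ⊥-elim (noneΨ k 1≤k k≤len
                                  (subst Ψ (extend-agrees path len y k k≤len) Ψk))
    ...   | inj₂ refl  = subst Ψ (extend-end path len y) Ψk

  boundary-Ψ : PathCondition → ∀ y → ℬ⁺ 𝒞[ R ] Reachable y → Ψ y
  boundary-Ψ cond y (inj₁ Ry , ¬Ry) = ⊥-elim (¬Ry Ry)
  boundary-Ψ cond y (inj₂ (a , Ra , r) , ¬Ry) with em {Φ y} | em {Ψ y}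
  ... | _        | yes Ψy  = Ψy
  ... | yes Φy   | no ¬Ψy  = ⊥-elim (¬Ry (fromWitness (reach-step Φy ¬Ψy)))
    where open Extension (toWitness Ra) r
  ... | no ¬Φy   | no _    = forced-Ψ cond ¬Φy
    where open Extension (toWitness Ra) r

  reachable-Φ : ∀ y → Reachable y → Φ y
  reachable-Φ y Ry = subst Φ end (allΦ len ≤-refl)
    where open Reach (toWitness Ry)

  path⇒until : Φ x × PathCondition → UntilHolds
  path⇒until (Φx , cond) =
    Reachable , lift (fromWitness (reach-start Φx)) , reachable-Φ , boundary-Ψ cond

  until⇔path : UntilHolds ⇔ (Φ x × PathCondition)
  until⇔path = mk⇔ until⇒path path⇒until

theorem3 : ExcludedMiddle (lsuc lzero) →
    (X : Set) (R : X → X → Set) (P : Set) (𝒱 : P → Subset X)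
    (x : X) (φ ψ : Formula P) →
    Sat R 𝒱 x (φ 𝒰 ψ)
      ⇔ (Sat R 𝒱 x φ
         × ((p : Path 𝒞[ R ]) → proj₁ p 0 ≡ x → (l : ℕ) →
              Sat R 𝒱 (proj₁ p l) (¬̇ φ) →
              Σ ℕ λ k → 1 ≤ k × k ≤ l × Sat R 𝒱 (proj₁ p k) ψ))
theorem3 em X R P 𝒱 x φ ψ =
  Until.until⇔path em R (λ y → Sat R 𝒱 y φ) (λ y → Sat R 𝒱 y ψ) x
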